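{- Let $\tau=(w,x)$ be a pair, $p=(i,j)\in X^c_\tau$, $p^\nwarrow_\tau=(i',j')$ and $p'=p^\uparrow_\tau=(i',j)$. Assume $P^\uparrow_\tau(p)$ is not satisfied. Then: (1) $p'$ is $\uparrow$-maximal with respect to $\tau$; (2) for any $p''=(i_1,j)$ with $i'\le i_1\le i$ we have $\mathrm{rk}_\tau(p'')\ge\mathrm{rk}_\tau(p)$, and if equality holds then $p''^\uparrow_\tau=p'$, $p''^\leftarrow_\tau=(i_1,j')$ and $P^\uparrow_\tau(p'')$ is not satisfied; (3) $p'^\leftarrow_\tau=p^\nwarrow_\tau$; (4) if $Q^\uparrow_\tau(p)$ is satisfied then $p'^\downarrow_\tau=(i'',j)$ with $i''>i$.
   Context: $S_n$ is the symmetric group on $\{1,\dots,n\}$ with Bruhat order $\le$; $\Box=\{0,\dots,n\}^2$. For $w\in S_n$, $\mathrm{rk}_w(i,j)=\#\{u\le i:w(u)\le j\}$ on $\Box$, and $D_w((i,j),(i',j'))=\mathrm{rk}_w(i,j)+\mathrm{rk}_w(i',j')-\mathrm{rk}_w(i,j')-\mathrm{rk}_w(i',j)$. A pair is $\tau=(w,x)$ with $x\le w$; $\mathrm{rk}_\tau=\mathrm{rk}_x-\mathrm{rk}_w$, $X_\tau=\{p\in\Box:\mathrm{rk}_\tau(p)=0\}$, $X^c_\tau=\Box\setminus X_\tau$. For $p=(i,j)\in\Box$ with $1\le j\le n-1$: $j^+=\min\{k>j:(i,k)\in X_\tau\}$, $i^+=\max\{l\ge i:(l,j^+)\in X_\tau,\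 D_w(p,(l,j^+))=0\}$, $p^\downarrow_\tau=(i^+,j)$; $j^-=\max\{k<j:(i,k)\in X_\tau\}$, $p^\leftarrow_\tau=(i,j^-)$, $i^-=\min\{l\le i:(l,j^-)\in X_\tau,\ D_w(p,(l,j^-))=0\}$, $p^\nwarrow_\tau=(i^-,j^-)$, $p^\uparrow_\tau=(i^-,j)$. $p$ is $\uparrow$-maximal w.r.t. $\tau$ if $p^\uparrow_\tau=p$. $P^\downarrow_\tau(p)$ means $\mathrm{rk}_\tau(p^\downarrow_\tau)<\mathrm{rk}_\tau(p)$, $P^\uparrow_\tau(p)$ means $\mathrm{rk}_\tau(p^\uparrow_\tau)<\mathrm{rk}_\tau(p)$, and $Q^\uparrow_\tau(p)$ means $P^\uparrow_\tau(p)\vee P^\downarrow_\tau(p^\uparrow_\tau)$. -}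

module Defs where

open import Data.Nat using (ℕ; zero; suc; _+_; _∸_; _<_; _<ᵇ_)
open import Data.Bool using (Bool; true; false; if_then_else_; _∧_)
open import Data.Fin using (Fin; toℕ) renaming (zero to fzero; suc to fsuc)
open import Data.Fin.Permutation using (Permutation′; _⟨$⟩ʳ_; transpose)
open import Data.Integer as ℤ using (ℤ; +_; _-_)
open import Data.Product using (_×_; _,_)
open import Relation.Binary.PropositionalEquality using (_≡_)
open import Relation.Binary.Construct.Closure.ReflexiveTransitive using (Star)
open import Relation.Nullary using (does)

-- Elements of S_n: permutations of Fin n; value u : Fin n stands for u+1 ∈ {1..n}.
Perm : ℕ → Set
Perm n = Permutation′ n

countFin : ∀ {n} → (Fin n → Bool) → ℕ
countFin {zero}  f = 0
countFin {suc n} f = (if f fzero then 1 else 0) + countFin (λ u → f (fsuc u))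

sumFin : ∀ {n} → (Fin n → ℕ) → ℕ
sumFin {zero}  f = 0
sumFin {suc n} f = f fzero + sumFin (λ u → f (fsuc u))

len : ∀ {n} → Perm n → ℕ
len {n} w = sumFin (λ a → countFin (λ b →
  (toℕ a <ᵇ toℕ b) ∧ (toℕ (w ⟨$⟩ʳ b) <ᵇ toℕ (w ⟨$⟩ʳ a))))

data BruhatStep {n : ℕ} (x y : Perm n) : Set where
  step : (a b : Fin n) → toℕ a < toℕ b →
         (∀ u → y ⟨$⟩ʳ u ≡ x ⟨$⟩ʳ (transpose a b ⟨$⟩ʳ u)) →
         len x < len y → BruhatStep x y

_≤B_ : ∀ {n} → Perm n → Perm n → Set
_≤B_ = Star BruhatStep

-- Points of the box {0..n}²
Pt : Set
Pt = ℕ × ℕ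

-- rk_w(i,j) = #{u ≤ i : w(u) ≤ j}
rk : ∀ {n} → Perm n → Pt → ℕ
rk w (i , j) = countFin (λ u → (toℕ u <ᵇ i) ∧ (toℕ (w ⟨$⟩ʳ u) <ᵇ j))

D : ∀ {n} → Perm n → Pt → Pt → ℤ
D w (i , j) (i' , j') =
  ((+ rk w (i , j) ℤ.+ + rk w (i' , j')) - + rk w (i , j')) - + rk w (i' , j)

record Pair (n : ℕ) : Set where
  constructor pair
  field
    w : Perm n
    x : Perm n
    x≤w : x ≤B w
open Pair public

rkτ : ∀ {n} → Pair n → Pt → ℤ
rkτ τ p = + rk (x τ) p - + rk (w τ) p

inX : ∀ {n} → Pair n → Pt → Bool
inX τ p = does (rkτ τ p ℤ.≟ + 0)

isZero : ℤ → Bool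
isZero z = does (z ℤ.≟ + 0)

-- greatest l ∈ [a, a+d] with P l (default a)
maxFrom : (ℕ → Bool) → ℕ → ℕ → ℕ
maxFrom P a zero    = a
maxFrom P a (suc d) = if P (a + suc d) then a + suc d else maxFrom P a d

maxIn : (ℕ → Bool) → ℕ → ℕ → ℕ
maxIn P a b = maxFrom P a (b ∸ a)

-- least l ∈ [b-d, b] with P l (default b)
minTo : (ℕ → Bool) → ℕ → ℕ → ℕ
minTo P b zero    = b
minTo P b (suc d) = if P (b ∸ suc d) then b ∸ suc d else minTo P b d

minIn : (ℕ → Bool) → ℕ → ℕ → ℕ
minIn P a b = minTo P b (b ∸ a)

module Arrows {n : ℕ} (τ : Pair n) where
  -- j⁺ = min{k > j : (i,k) ∈ X_τ}   (k ≤ n; (i,n) ∈ X_τ always)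
  jplus : Pt → ℕ
  jplus (i , j) = minIn (λ k → inX τ (i , k)) (suc j) n

  iplus : Pt → ℕ
  iplus p@(i , j) = maxIn (λ l → inX τ (l , jplus p) ∧ isZero (D (w τ) p (l , jplus p))) i n

  down : Pt → Pt
  down p@(i , j) = (iplus p , j)

  -- j⁻ = max{k < j : (i,k) ∈ X_τ}   ((i,0) ∈ X_τ always)
  jminus : Pt → ℕ
  jminus (i , j) = maxIn (λ k → inX τ (i , k)) 0 (j ∸ 1)

  left : Pt → Pt
  left p@(i , j) = (i , jminus p)

  iminus : Pt → ℕ
  iminus p@(i , j) = minIn (λ l → inX τ (l , jminus p) ∧ isZero (D (w τ) p (l , jminus p))) 0 i

  nw : Pt → Pt
  nw p = (iminus p , jminus p)

  up : Pt → Pt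
  up p@(i , j) = (iminus p , j)

  Pdown : Pt → Set
  Pdown p = rkτ τ (down p) ℤ.< rkτ τ p

  Pup : Pt → Set
  Pup p = rkτ τ (up p) ℤ.< rkτ τ p

  Qup : Pt → Set
  Qup p = Pup p Data.Sum.⊎ Pdown (up p)
    where import Data.Sum

module Submission where

-- Everything is reduced to counting points of a permutation graph in
-- rectangles.  Writing Box_π(l,i,k,j) for #{u : l ≤ u < i, k ≤ π(u) < j},
-- rank functions satisfy the rectangle identity
--   rk_π(i,j) + rk_π(l,k) = rk_π(i,k) + rk_π(l,j) + Box_π(l,i,k,j)   (l ≤ i, k ≤ j),
-- so in particular D_w(p,(l,k)) = Box_w(l,i,k,j).  Bruhat monotonicity
-- (x ≤ w implies rk_w ≤ rk_x, via the classical inversion count for one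
-- transposition step) makes rk_τ a natural number r, and the identities
-- for x and w combine to
--   r(i,j) + r(l,k) + Box_w = r(i,k) + r(l,j) + Box_x.
-- The arrows are bounded searches, characterised by "attained, and nothing
-- further out" lemmas.  With p^↖ = (i',j') the search conditions give
-- r(i,j') = r(i',j') = 0 and Box_w(i',i,j',j) = 0, hence
-- r(i,j) = r(i',j) + Box_x(i',i,j',j); ¬P↑(p) forces Box_x = 0, and every
-- point (i₁,j) with i' ≤ i₁ ≤ i of the same rank inherits all of p's corner
-- data.  Parts (1)-(4) of the lemma are read off from this.

open import Defs
open import Data.Nat using (ℕ; _≤_; _<_)
open import Data.Integer as ℤ using ()
open import Data.Product using (_×_; _,_; ∃)
open import Relation.Binary.PropositionalEquality using (_≡_; _≢_)
open import Relation.Nullary using (¬_)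

open import Data.Nat using (zero; suc; _+_; _∸_; _<ᵇ_; z≤n; s≤s⁻¹; z<s; _≤?_)
open import Data.Nat.Properties
open import Data.Nat.Tactic.RingSolver using (solve-∀)
open import Data.Bool using (Bool; true; false; _∧_; not; T; if_then_else_)
open import Data.Bool.Properties using (T-∧)
open import Data.Unit using (tt)
open import Data.Empty using (⊥-elim)
open import Data.Product using (proj₁; proj₂)
open import Data.Sum using (inj₁; inj₂)
open ℤ using (ℤ; +_)
import Data.Integer.Properties as ℤP
import Data.Integer.Tactic.RingSolver as ℤSolver
open import Data.Fin using (Fin; toℕ; fromℕ<) renaming (zero to fzero; suc to fsuc)
import Data.Fin.Properties as FinP
import Data.Fin.Permutation.Components as PC
open import Data.Fin.Permutation using (_⟨$⟩ʳ_)
open import Function.Bundles using (Equivalence)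
open import Relation.Binary.PropositionalEquality using (refl; sym; trans; cong; cong₂; subst; subst₂)
open import Relation.Nullary using (Dec; yes; no; does)
open import Relation.Nullary.Decidable using (dec-true; dec-false)
open import Relation.Binary.Construct.Closure.ReflexiveTransitive using (ε; _◅_)
open import Relation.Binary using (tri<; tri≈; tri>)

ind : Bool → ℕ
ind b = if b then 1 else 0

∧-intro : ∀ {a b} → T a → T b → T (a ∧ b)
∧-intro {a} {b} ta tb = Equivalence.from (T-∧ {a} {b}) (ta , tb)

∧-fst : ∀ {a b} → T (a ∧ b) → T a
∧-fst {a} {b} t = proj₁ (Equivalence.to (T-∧ {a} {b}) t)

∧-snd : ∀ {a b} → T (a ∧ b) → T b
∧-snd {a} {b} t = proj₂ (Equivalence.to (T-∧ {a} {b}) t)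

ind-mono : ∀ {a b} → (T a → T b) → ind a ≤ ind b
ind-mono {false} h = z≤n
ind-mono {true} {true} h = ≤-refl
ind-mono {true} {false} h = ⊥-elim (h tt)

ind-false : ∀ {a} → ¬ T a → ind a ≡ 0
ind-false {false} _ = refl
ind-false {true} h = ⊥-elim (h tt)

ind-exchange : ∀ (p q A B : Bool) → (T p → T q) → (T A → T B) →
  ind (p ∧ B) + ind (q ∧ A) ≤ ind (p ∧ A) + ind (q ∧ B)
ind-exchange false false A B h k = z≤n
ind-exchange false true false B h k = z≤n
ind-exchange false true true false h k = ⊥-elim (k tt)
ind-exchange false true true true h k = ≤-refl
ind-exchange true false A B h k = ⊥-elim (h tt)
ind-exchange true true false false h k = ≤-refl
ind-exchange true true false true h k = ≤-refl
ind-exchange true true true false h k = ⊥-elim (k tt)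
ind-exchange true true true true h k = ≤-refl

-- Inclusion–exclusion for two nested pairs of conditions P₁ ⇒ P₂,
-- Q₁ ⇒ Q₂: the pointwise form of the rectangle identity.
ind-rectangle : ∀ (P₁ P₂ Q₁ Q₂ : Bool) → (T P₁ → T P₂) → (T Q₁ → T Q₂) →
  ind (P₂ ∧ Q₂) + ind (P₁ ∧ Q₁)
    ≡ ind (P₂ ∧ Q₁) + ind (P₁ ∧ Q₂) + ind ((not P₁ ∧ P₂) ∧ (not Q₁ ∧ Q₂))
ind-rectangle false false false false h k = refl
ind-rectangle false false false true h k = refl
ind-rectangle false false true false h k = ⊥-elim (k tt)
ind-rectangle false false true true h k = refl
ind-rectangle false true false false h k = refl
ind-rectangle false true false true h k = refl
ind-rectangle false true true false h k = ⊥-elim (k tt)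
ind-rectangle false true true true h k = refl
ind-rectangle true false Q₁ Q₂ h k = ⊥-elim (h tt)
ind-rectangle true true false false h k = refl
ind-rectangle true true false true h k = refl
ind-rectangle true true true false h k = ⊥-elim (k tt)
ind-rectangle true true true true h k = refl

does⇒ : ∀ {A : Set} (d : Dec A) → T (does d) → A
does⇒ (yes a) _ = a

⇒does : ∀ {A : Set} (d : Dec A) → A → T (does d)
⇒does (yes _) _ = tt
⇒does (no ¬a) a = ¬a a

_∈[_,_⟩ : ℕ → ℕ → ℕ → Bool
u ∈[ l , i ⟩ = not (u <ᵇ l) ∧ (u <ᵇ i)

∈[⟩⇒ : ∀ u l i → T (u ∈[ l , i ⟩) → l ≤ u × u < i
∈[⟩⇒ u l i t with u <ᵇ l in e
... | false = ≮⇒≥ (λ u<l → subst T e (<⇒<ᵇ u<l)) , <ᵇ⇒< u i t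

⇒∈[⟩ : ∀ {u l i} → l ≤ u → u < i → T (u ∈[ l , i ⟩)
⇒∈[⟩ {u} {l} {i} l≤u u<i with u <ᵇ l in e
... | false = <⇒<ᵇ u<i
... | true = ⊥-elim (≤⇒≯ l≤u (<ᵇ⇒< u l (subst T (sym e) tt)))

sumTo : ℕ → (ℕ → ℕ) → ℕ
sumTo zero F = 0
sumTo (suc n) F = sumTo n F + F n

sumTo-mono : ∀ n {F G : ℕ → ℕ} → (∀ v → v < n → F v ≤ G v) → sumTo n F ≤ sumTo n G
sumTo-mono zero h = z≤n
sumTo-mono (suc n) h = +-mono-≤ (sumTo-mono n (λ v v<n → h v (m<n⇒m<1+n v<n))) (h n ≤-refl)

sumTo-cong : ∀ n {F G : ℕ → ℕ} → (∀ v → F v ≡ G v) → sumTo n F ≡ sumTo n G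
sumTo-cong zero h = refl
sumTo-cong (suc n) h = cong₂ _+_ (sumTo-cong n h) (h n)

sumTo-zero : ∀ n (F : ℕ → ℕ) → (∀ v → F v ≡ 0) → sumTo n F ≡ 0
sumTo-zero zero F h = refl
sumTo-zero (suc n) F h = cong₂ _+_ (sumTo-zero n F h) (h n)

sumTo-+ : ∀ n (F G : ℕ → ℕ) → sumTo n (λ v → F v + G v) ≡ sumTo n F + sumTo n G
sumTo-+ zero F G = refl
sumTo-+ (suc n) F G =
  trans (cong (_+ (F n + G n)) (sumTo-+ n F G)) (interchange (sumTo n F) (sumTo n G) (F n) (G n))
  where
  interchange : ∀ a b c d → (a + b) + (c + d) ≡ (a + c) + (b + d)
  interchange = solve-∀

sumTo-suc : ∀ n (F : ℕ → ℕ) → sumTo (suc n) F ≡ F 0 + sumTo n (λ v → F (suc v))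
sumTo-suc zero F = sym (+-identityʳ (F 0))
sumTo-suc (suc n) F = trans (cong (_+ F (suc n)) (sumTo-suc n F)) (+-assoc (F 0) _ _)

-- Monotonicity when F ≤ G fails at one point a, but is compensated there;
-- the offsets c, d make the induction go through.
sumTo-mono-except₁ : ∀ n {F G : ℕ → ℕ} a c d → a < n →
  (∀ v → v < n → v ≢ a → F v ≤ G v) →
  F a + c ≤ G a + d → sumTo n F + c ≤ sumTo n G + d
sumTo-mono-except₁ zero a c d () h k
sumTo-mono-except₁ (suc m) {F} {G} a c d a<n h k with a ≟ m
... | yes refl = subst₂ _≤_ (sym (+-assoc (sumTo m F) (F m) c)) (sym (+-assoc (sumTo m G) (G m) d))
      (+-mono-≤ (sumTo-mono m (λ v v<m → h v (m<n⇒m<1+n v<m) (<⇒≢ v<m))) k)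
... | no a≢m = subst₂ _≤_ (+-rearrange (sumTo m F) c (F m)) (+-rearrange (sumTo m G) d (G m))
      (+-mono-≤ (sumTo-mono-except₁ m a c d (≤∧≢⇒< (s≤s⁻¹ a<n) a≢m)
                   (λ v v<m v≢a → h v (m<n⇒m<1+n v<m) v≢a) k)
                (h m ≤-refl (λ e → a≢m (sym e))))
  where
  +-rearrange : ∀ x y z → x + y + z ≡ x + z + y
  +-rearrange = solve-∀

sumTo-mono-except₂′ : ∀ n {F G : ℕ → ℕ} a b c d → a < b → b < n →
  (∀ v → v < n → v ≢ a → v ≢ b → F v ≤ G v) →
  F a + F b + c ≤ G a + G b + d → sumTo n F + c ≤ sumTo n G + d
sumTo-mono-except₂′ zero a b c d a<b () h k
sumTo-mono-except₂′ (suc m) {F} {G} a b c d a<b b<n h k with b ≟ m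
... | yes refl = subst₂ _≤_ (sym (+-assoc (sumTo m F) (F m) c)) (sym (+-assoc (sumTo m G) (G m) d))
      (sumTo-mono-except₁ m a (F m + c) (G m + d) a<b
        (λ v v<m v≢a → h v (m<n⇒m<1+n v<m) v≢a (<⇒≢ v<m))
        (subst₂ _≤_ (+-assoc (F a) (F m) c) (+-assoc (G a) (G m) d) k))
... | no b≢m = subst₂ _≤_ (+-rearrange (sumTo m F) c (F m)) (+-rearrange (sumTo m G) d (G m))
      (+-mono-≤ (sumTo-mono-except₂′ m a b c d a<b b<m
                   (λ v v<m v≢a v≢b → h v (m<n⇒m<1+n v<m) v≢a v≢b) k)
                (h m ≤-refl (λ e → <⇒≢ (<-trans a<b b<m) (sym e)) (λ e → b≢m (sym e))))
  where
  b<m : b < m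
  b<m = ≤∧≢⇒< (s≤s⁻¹ b<n) b≢m
  +-rearrange : ∀ x y z → x + y + z ≡ x + z + y
  +-rearrange = solve-∀

sumTo-mono-except₂ : ∀ n {F G : ℕ → ℕ} a b → a < b → b < n →
  (∀ v → v < n → v ≢ a → v ≢ b → F v ≤ G v) →
  F a + F b ≤ G a + G b → sumTo n F ≤ sumTo n G
sumTo-mono-except₂ n {F} {G} a b a<b b<n h k =
  subst₂ _≤_ (+-identityʳ (sumTo n F)) (+-identityʳ (sumTo n G))
    (sumTo-mono-except₂′ n a b 0 0 a<b b<n h (+-mono-≤ k z≤n))

sumFin≡sumTo : ∀ {n} (f : Fin n → ℕ) (F : ℕ → ℕ) → (∀ u → f u ≡ F (toℕ u)) →
  sumFin f ≡ sumTo n F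
sumFin≡sumTo {zero} f F h = refl
sumFin≡sumTo {suc n} f F h =
  trans (cong₂ _+_ (h fzero) (sumFin≡sumTo (λ u → f (fsuc u)) (λ v → F (suc v)) (λ u → h (fsuc u))))
        (sym (sumTo-suc n F))

countFin≡sumTo : ∀ {n} (f : Fin n → Bool) (F : ℕ → Bool) → (∀ u → f u ≡ F (toℕ u)) →
  countFin f ≡ sumTo n (λ v → ind (F v))
countFin≡sumTo {zero} f F h = refl
countFin≡sumTo {suc n} f F h =
  trans (cong₂ _+_ (cong ind (h fzero)) (countFin≡sumTo (λ u → f (fsuc u)) (λ v → F (suc v)) (λ u → h (fsuc u))))
        (sym (sumTo-suc n (λ v → ind (F v))))

extend : ∀ {n} → (Fin n → ℕ) → ℕ → ℕ
extend {zero} f k = 0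
extend {suc n} f zero = f fzero
extend {suc n} f (suc k) = extend (λ u → f (fsuc u)) k

extend-toℕ : ∀ {n} (f : Fin n → ℕ) u → extend f (toℕ u) ≡ f u
extend-toℕ f fzero = refl
extend-toℕ f (fsuc u) = extend-toℕ (λ v → f (fsuc v)) u

graph : ∀ {n} → Perm n → ℕ → ℕ
graph π = extend (λ u → toℕ (π ⟨$⟩ʳ u))

graph-toℕ : ∀ {n} (π : Perm n) u → graph π (toℕ u) ≡ toℕ (π ⟨$⟩ʳ u)
graph-toℕ π = extend-toℕ (λ u → toℕ (π ⟨$⟩ʳ u))

Rk : ℕ → (ℕ → ℕ) → ℕ → ℕ → ℕ
Rk n g i j = sumTo n (λ u → ind ((u <ᵇ i) ∧ (g u <ᵇ j)))

invRow : (ℕ → ℕ) → ℕ → ℕ → ℕ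
invRow g u v = ind ((u <ᵇ v) ∧ (g v <ᵇ g u))

Inv : ℕ → (ℕ → ℕ) → ℕ
Inv n g = sumTo n (λ u → sumTo n (invRow g u))

rk≡Rk : ∀ {n} (π : Perm n) i j → rk π (i , j) ≡ Rk n (graph π) i j
rk≡Rk π i j = countFin≡sumTo _ _ (λ u → cong (λ z → (toℕ u <ᵇ i) ∧ (z <ᵇ j)) (sym (graph-toℕ π u)))

len≡Inv : ∀ {n} (π : Perm n) → len π ≡ Inv n (graph π)
len≡Inv π = sumFin≡sumTo _ _ (λ a → countFin≡sumTo _ _ (λ b →
  cong₂ (λ z z' → (toℕ a <ᵇ toℕ b) ∧ (z <ᵇ z')) (sym (graph-toℕ π b)) (sym (graph-toℕ π a))))

module Swap (n : ℕ) (gx gy : ℕ → ℕ) (a b : ℕ) (a<b : a < b) (b<n : b < n)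
  (gy-a : gy a ≡ gx b) (gy-b : gy b ≡ gx a)
  (gy-other : ∀ v → v < n → v ≢ a → v ≢ b → gy v ≡ gx v) where

  -- If gx(a) < gx(b), the swap lowers every rank: a point moves from
  -- (a, gx a) to (a, gx b) and another from (b, gx b) to (b, gx a).
  rank-≤ : gx a < gx b → ∀ i j → Rk n gy i j ≤ Rk n gx i j
  rank-≤ gxa<gxb i j = sumTo-mono-except₂ n a b a<b b<n
    (λ v v<n v≢a v≢b → ≤-reflexive (cong (λ z → ind ((v <ᵇ i) ∧ (z <ᵇ j))) (gy-other v v<n v≢a v≢b)))
    (subst₂ _≤_
      (trans (+-comm (ind ((b <ᵇ i) ∧ (gx a <ᵇ j))) (ind ((a <ᵇ i) ∧ (gx b <ᵇ j))))
             (cong₂ _+_ (cong (λ z → ind ((a <ᵇ i) ∧ (z <ᵇ j))) (sym gy-a))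
                        (cong (λ z → ind ((b <ᵇ i) ∧ (z <ᵇ j))) (sym gy-b))))
      (+-comm (ind ((b <ᵇ i) ∧ (gx b <ᵇ j))) (ind ((a <ᵇ i) ∧ (gx a <ᵇ j))))
      (ind-exchange (b <ᵇ i) (a <ᵇ i) (gx b <ᵇ j) (gx a <ᵇ j)
        (λ t → <⇒<ᵇ (<-trans a<b (<ᵇ⇒< b i t)))
        (λ t → <⇒<ᵇ (<-trans gxa<gxb (<ᵇ⇒< (gx b) j t)))))

  -- If gx(b) ≤ gx(a), the swap does not create inversions.  Rows u other
  -- than a, b are compared through their entries at a and b; rows a and b
  -- are compared together, column by column.
  module _ (gxb≤gxa : gx b ≤ gx a) where

    row-≤ : ∀ u → u < n → u ≢ a → u ≢ b → sumTo n (invRow gy u) ≤ sumTo n (invRow gx u)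
    row-≤ u u<n u≢a u≢b = sumTo-mono-except₂ n a b a<b b<n
        (λ v v<n v≢a v≢b → ≤-reflexive (cong₂ (λ s t → ind ((u <ᵇ v) ∧ (s <ᵇ t))) (gy-other v v<n v≢a v≢b) gy-u))
        (subst₂ (λ s t → s + t ≤ invRow gx u a + invRow gx u b)
          (sym (cong₂ (λ s t → ind ((u <ᵇ a) ∧ (s <ᵇ t))) gy-a gy-u))
          (sym (cong₂ (λ s t → ind ((u <ᵇ b) ∧ (s <ᵇ t))) gy-b gy-u))
          (ind-exchange (u <ᵇ a) (u <ᵇ b) (gx a <ᵇ gx u) (gx b <ᵇ gx u)
            (λ t → <⇒<ᵇ (<-trans (<ᵇ⇒< u a t) a<b))
            (λ t → <⇒<ᵇ (≤-<-trans gxb≤gxa (<ᵇ⇒< (gx a) (gx u) t)))))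
      where
      gy-u : gy u ≡ gx u
      gy-u = gy-other u u<n u≢a u≢b

    column-≤ : ∀ v → v < n → invRow gy a v + invRow gy b v ≤ invRow gx a v + invRow gx b v
    column-≤ v v<n with v ≟ a | v ≟ b
    ... | yes refl | _ = subst (_≤ invRow gx a v + invRow gx b v)
          (sym (cong₂ _+_ (ind-false (λ t → <-irrefl refl (<ᵇ⇒< v v (∧-fst t))))
                          (ind-false (λ t → <-asym a<b (<ᵇ⇒< b v (∧-fst t))))))
          z≤n
    ... | no _ | yes refl = subst (_≤ invRow gx a v + invRow gx b v)
          (sym (cong₂ _+_ (ind-false (λ t → ≤⇒≯ gxb≤gxa (subst₂ _<_ gy-b gy-a (<ᵇ⇒< (gy v) (gy a) (∧-snd {a <ᵇ v} t)))))
                          (ind-false (λ t → <-irrefl refl (<ᵇ⇒< v v (∧-fst t))))))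
          z≤n
    ... | no v≢a | no v≢b = subst₂ _≤_
          (trans (+-comm (ind ((b <ᵇ v) ∧ (gx v <ᵇ gx a))) (ind ((a <ᵇ v) ∧ (gx v <ᵇ gx b))))
             (cong₂ _+_ (cong₂ (λ s t → ind ((a <ᵇ v) ∧ (s <ᵇ t))) (sym gy-v) (sym gy-a))
                        (cong₂ (λ s t → ind ((b <ᵇ v) ∧ (s <ᵇ t))) (sym gy-v) (sym gy-b))))
          (+-comm (ind ((b <ᵇ v) ∧ (gx v <ᵇ gx b))) (ind ((a <ᵇ v) ∧ (gx v <ᵇ gx a))))
          (ind-exchange (b <ᵇ v) (a <ᵇ v) (gx v <ᵇ gx b) (gx v <ᵇ gx a)
            (λ t → <⇒<ᵇ (<-trans a<b (<ᵇ⇒< b v t)))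
            (λ t → <⇒<ᵇ (<-≤-trans (<ᵇ⇒< (gx v) (gx b) t) gxb≤gxa)))
      where
      gy-v : gy v ≡ gx v
      gy-v = gy-other v v<n v≢a v≢b

    inv-≤ : Inv n gy ≤ Inv n gx
    inv-≤ = sumTo-mono-except₂ n a b a<b b<n row-≤
      (subst₂ _≤_ (sumTo-+ n _ _) (sumTo-+ n _ _) (sumTo-mono n column-≤))

transpose-left : ∀ {n} (i j : Fin n) → PC.transpose i j i ≡ j
transpose-left i j rewrite dec-true (i FinP.≟ i) refl = refl

transpose-right : ∀ {n} (i j : Fin n) → PC.transpose i j j ≡ i
transpose-right i j with j FinP.≟ i
... | yes refl = refl
... | no _ rewrite dec-true (j FinP.≟ j) refl = refl

transpose-other : ∀ {n} (i j k : Fin n) → k ≢ i → k ≢ j → PC.transpose i j k ≡ k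
transpose-other i j k k≢i k≢j rewrite dec-false (k FinP.≟ i) k≢i | dec-false (k FinP.≟ j) k≢j = refl

-- One Bruhat step σ → π = σ·(a b) lowers every rank: ℓ(σ) < ℓ(π) forces
-- σ(a) < σ(b) (otherwise the swap would not add inversions), and then the
-- swap moves points of the graph rightwards.
step-rk-≤ : ∀ {n} {σ π : Perm n} → BruhatStep σ π → ∀ p → rk π p ≤ rk σ p
step-rk-≤ {n} {σ} {π} (step A B A<B π≡σ∘t σ<π) (i , j) =
  subst₂ _≤_ (sym (rk≡Rk π i j)) (sym (rk≡Rk σ i j)) (S.rank-≤ σa<σb i j)
  where
  a b : ℕ
  a = toℕ A
  b = toℕ B
  gπ-at : ∀ u v → PC.transpose A B u ≡ v → graph π (toℕ u) ≡ graph σ (toℕ v)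
  gπ-at u v t≡ = trans (graph-toℕ π u) (trans (cong toℕ (π≡σ∘t u))
                   (trans (cong (λ z → toℕ (σ ⟨$⟩ʳ z)) t≡) (sym (graph-toℕ σ v))))
  gπ-other : ∀ v → v < n → v ≢ a → v ≢ b → graph π v ≡ graph σ v
  gπ-other v v<n v≢a v≢b = subst (λ z → graph π z ≡ graph σ z) (FinP.toℕ-fromℕ< v<n)
    (gπ-at u u (transpose-other A B u (λ e → v≢a (trans (sym (FinP.toℕ-fromℕ< v<n)) (cong toℕ e)))
                                      (λ e → v≢b (trans (sym (FinP.toℕ-fromℕ< v<n)) (cong toℕ e)))))
    where
    u : Fin n
    u = fromℕ< v<n
  module S = Swap n (graph σ) (graph π) a b A<B (FinP.toℕ<n B)
    (gπ-at A B (transpose-left A B)) (gπ-at B A (transpose-right A B)) gπ-other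
  σa<σb : graph σ a < graph σ b
  σa<σb with graph σ a <? graph σ b
  ... | yes lt = lt
  ... | no ≮ = ⊥-elim (<⇒≱ σ<π (subst₂ _≤_ (sym (len≡Inv π)) (sym (len≡Inv σ)) (S.inv-≤ (≮⇒≥ ≮))))

rk-antitone : ∀ {n} {σ π : Perm n} → σ ≤B π → ∀ p → rk π p ≤ rk σ p
rk-antitone ε p = ≤-refl
rk-antitone (s ◅ r) p = ≤-trans (rk-antitone r p) (step-rk-≤ s p)

-- Box counts are used only through the lemmas in this block; keeping them
-- opaque lets Agda identify a box by its four bounds when inferring them.
opaque
  Box : ℕ → (ℕ → ℕ) → ℕ → ℕ → ℕ → ℕ → ℕ
  Box n g l i k j = sumTo n (λ u → ind (u ∈[ l , i ⟩ ∧ g u ∈[ k , j ⟩))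

  Rk-rectangle : ∀ n g l i k j → l ≤ i → k ≤ j →
    Rk n g i j + Rk n g l k ≡ Rk n g i k + Rk n g l j + Box n g l i k j
  Rk-rectangle n g l i k j l≤i k≤j =
    trans (sym (sumTo-+ n _ _))
      (trans (sumTo-cong n (λ u → ind-rectangle (u <ᵇ l) (u <ᵇ i) (g u <ᵇ k) (g u <ᵇ j)
                         (λ t → <⇒<ᵇ (<-≤-trans (<ᵇ⇒< u l t) l≤i))
                         (λ t → <⇒<ᵇ (<-≤-trans (<ᵇ⇒< (g u) k t) k≤j))))
        (trans (sumTo-+ n _ _) (cong (_+ Box n g l i k j) (sumTo-+ n _ _))))

  ∈[⟩-weaken : ∀ {u l i l' i'} → l ≤ l' → i' ≤ i → T (u ∈[ l' , i' ⟩) → T (u ∈[ l , i ⟩)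
  ∈[⟩-weaken {u} {l' = l'} {i'} l≤l' i'≤i t with ∈[⟩⇒ u l' i' t
  ... | l'≤u , u<i' = ⇒∈[⟩ (≤-trans l≤l' l'≤u) (<-≤-trans u<i' i'≤i)

  Box-mono : ∀ n g {l i k j l' i' k' j'} → l ≤ l' → i' ≤ i → k ≤ k' → j' ≤ j →
    Box n g l' i' k' j' ≤ Box n g l i k j
  Box-mono n g {l' = l'} {i'} l≤l' i'≤i k≤k' j'≤j = sumTo-mono n (λ u _ → ind-mono (λ t →
    ∧-intro (∈[⟩-weaken l≤l' i'≤i (∧-fst t)) (∈[⟩-weaken k≤k' j'≤j (∧-snd {u ∈[ l' , i' ⟩} t))))

  Box-empty : ∀ n g l k j → Box n g l l k j ≡ 0
  Box-empty n g l k j = sumTo-zero n _ (λ u → ind-false (λ t →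
    let (l≤u , u<l) = ∈[⟩⇒ u l l (∧-fst t) in <⇒≱ u<l l≤u))

  Box-split : ∀ n g l m i k j → Box n g l i k j ≤ Box n g l m k j + Box n g m i k j
  Box-split n g l m i k j = subst (Box n g l i k j ≤_) (sumTo-+ n _ _) (sumTo-mono n split)
    where
    split : ∀ u → u < n → ind (u ∈[ l , i ⟩ ∧ g u ∈[ k , j ⟩)
                     ≤ ind (u ∈[ l , m ⟩ ∧ g u ∈[ k , j ⟩) + ind (u ∈[ m , i ⟩ ∧ g u ∈[ k , j ⟩)
    split u _ with u <? m
    ... | yes u<m = ≤-trans (ind-mono (λ t → ∧-intro (⇒∈[⟩ (proj₁ (∈[⟩⇒ u l i (∧-fst t))) u<m)
                                                      (∧-snd {u ∈[ l , i ⟩} t)))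
                            (m≤m+n _ _)
    ... | no u≮m = ≤-trans (ind-mono (λ t → ∧-intro (⇒∈[⟩ (≮⇒≥ u≮m) (proj₂ (∈[⟩⇒ u l i (∧-fst t))))
                                                     (∧-snd {u ∈[ l , i ⟩} t)))
                           (m≤n+m _ _)

maxFrom-≥ : ∀ (P : ℕ → Bool) a d → a ≤ maxFrom P a d
maxFrom-≥ P a zero = ≤-refl
maxFrom-≥ P a (suc d) with P (a + suc d)
... | true = m≤m+n a (suc d)
... | false = maxFrom-≥ P a d

maxFrom-≤ : ∀ (P : ℕ → Bool) a d → maxFrom P a d ≤ a + d
maxFrom-≤ P a zero = ≤-reflexive (sym (+-identityʳ a))
maxFrom-≤ P a (suc d) with P (a + suc d)
... | true = ≤-refl
... | false = ≤-trans (maxFrom-≤ P a d) (+-monoʳ-≤ a (n≤1+n d))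

maxFrom-sat : ∀ (P : ℕ → Bool) a d → T (P a) → T (P (maxFrom P a d))
maxFrom-sat P a zero t = t
maxFrom-sat P a (suc d) t with P (a + suc d) in e
... | true = subst T (sym e) tt
... | false = maxFrom-sat P a d t

maxFrom-above : ∀ (P : ℕ → Bool) a d k → maxFrom P a d < k → k ≤ a + d → ¬ T (P k)
maxFrom-above P a zero k lt le = ⊥-elim (<⇒≱ lt (subst (k ≤_) (+-identityʳ a) le))
maxFrom-above P a (suc d) k lt le with P (a + suc d) in e
... | true = ⊥-elim (<⇒≱ lt le)
... | false with k ≟ a + suc d
...   | yes refl = λ t → subst T e t
...   | no k≢ = maxFrom-above P a d k lt (s≤s⁻¹ (subst (k <_) (+-suc a d) (≤∧≢⇒< le k≢)))

maxFrom-unique : ∀ (P : ℕ → Bool) a d k → k ≤ a + d → T (P a) → T (P k) →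
  (∀ k' → k < k' → k' ≤ a + d → ¬ T (P k')) → maxFrom P a d ≡ k
maxFrom-unique P a d k le ta tk h with <-cmp (maxFrom P a d) k
... | tri< lt _ _ = ⊥-elim (maxFrom-above P a d k lt le tk)
... | tri≈ _ eq _ = eq
... | tri> _ _ gt = ⊥-elim (h _ gt (maxFrom-≤ P a d) (maxFrom-sat P a d ta))

minTo-≤ : ∀ (P : ℕ → Bool) b d → minTo P b d ≤ b
minTo-≤ P b zero = ≤-refl
minTo-≤ P b (suc d) with P (b ∸ suc d)
... | true = m∸n≤m b (suc d)
... | false = minTo-≤ P b d

minTo-sat : ∀ (P : ℕ → Bool) b d → T (P b) → T (P (minTo P b d))
minTo-sat P b zero t = t
minTo-sat P b (suc d) t with P (b ∸ suc d) in e
... | true = subst T (sym e) tt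
... | false = minTo-sat P b d t

∸-step : ∀ b d → b ∸ d ≤ suc (b ∸ suc d)
∸-step zero zero = z≤n
∸-step zero (suc d) = z≤n
∸-step (suc b) zero = ≤-refl
∸-step (suc b) (suc d) = ∸-step b d

minTo-below : ∀ (P : ℕ → Bool) b d l → b ∸ d ≤ l → l < minTo P b d → ¬ T (P l)
minTo-below P b zero l le lt = ⊥-elim (<⇒≱ lt le)
minTo-below P b (suc d) l le lt with P (b ∸ suc d) in e
... | true = ⊥-elim (<⇒≱ lt le)
... | false with l ≟ b ∸ suc d
...   | yes refl = λ t → subst T e t
...   | no l≢ = minTo-below P b d l (≤-trans (∸-step b d) (≤∧≢⇒< le (λ q → l≢ (sym q)))) lt

minTo-below₀ : ∀ (P : ℕ → Bool) b l → l < minTo P b b → ¬ T (P l)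
minTo-below₀ P b l = minTo-below P b b l (subst (_≤ l) (sym (n∸n≡0 b)) z≤n)

minTo-unique : ∀ (P : ℕ → Bool) b l → T (P b) → T (P l) →
  (∀ l' → l' < l → ¬ T (P l')) → minTo P b b ≡ l
minTo-unique P b l tb tl h with <-cmp (minTo P b b) l
... | tri< lt _ _ = ⊥-elim (h _ lt (minTo-sat P b b tb))
... | tri≈ _ eq _ = eq
... | tri> _ _ gt = ⊥-elim (minTo-below₀ P b l gt tl)

≮-+⇒≡0 : ∀ m o → ¬ m < m + o → o ≡ 0
≮-+⇒≡0 m zero _ = refl
≮-+⇒≡0 m (suc o) h = ⊥-elim (h (m<m+n m z<s))

D-from-rectangle : ∀ A B C E M → A + B ≡ C + E + M → ((+ A ℤ.+ + B) ℤ.- + C) ℤ.- + E ≡ + M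
D-from-rectangle A B C E M h =
  trans (cong (λ z → (z ℤ.- + C) ℤ.- + E)
          (trans (sym (ℤP.pos-+ A B))
            (trans (cong +_ h) (trans (ℤP.pos-+ (C + E) M) (cong (ℤ._+ + M) (ℤP.pos-+ C E))))))
        (cancel (+ C) (+ E) (+ M))
  where
  cancel : ∀ (c e m : ℤ) → (((c ℤ.+ e) ℤ.+ m) ℤ.- c) ℤ.- e ≡ m
  cancel = ℤSolver.solve-∀

-- Subtracting the rectangle identity of w from that of x.
rectangle-difference : ∀ A B C E a b c e X Y →
  (A + a) + (B + b) ≡ (C + c) + (E + e) + X → A + B ≡ C + E + Y → a + b + Y ≡ c + e + X
rectangle-difference A B C E a b c e X Y hx hw = +-cancelˡ-≡ (C + E) _ _
  (trans (shuffle₁ C E Y a b) (trans (cong (_+ (a + b)) (sym hw))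
    (trans (shuffle₂ A B a b) (trans hx (shuffle₃ C E c e X)))))
  where
  shuffle₁ : ∀ C E Y a b → C + E + (a + b + Y) ≡ C + E + Y + (a + b)
  shuffle₁ = solve-∀
  shuffle₂ : ∀ A B a b → A + B + (a + b) ≡ (A + a) + (B + b)
  shuffle₂ = solve-∀
  shuffle₃ : ∀ C E c e X → (C + c) + (E + e) + X ≡ C + E + (c + e + X)
  shuffle₃ = solve-∀

module PairRank {n : ℕ} (τ : Pair n) where

  rkw rkx r : Pt → ℕ
  rkw = rk (w τ)
  rkx = rk (x τ)
  r p = rkx p ∸ rkw p

  rkx≡rkw+r : ∀ p → rkx p ≡ rkw p + r p
  rkx≡rkw+r p = sym (m+[n∸m]≡n (rk-antitone (x≤w τ) p))

  rkτ≡r : ∀ p → rkτ τ p ≡ + r p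
  rkτ≡r p = trans (ℤP.m-n≡m⊖n (rkx p) (rkw p)) (ℤP.⊖-≥ (rk-antitone (x≤w τ) p))

  rkτ-< : ∀ p q → r p < r q → rkτ τ p ℤ.< rkτ τ q
  rkτ-< p q lt = subst₂ ℤ._<_ (sym (rkτ≡r p)) (sym (rkτ≡r q)) (ℤ.+<+ lt)

  rkτ-<⁻ : ∀ p q → rkτ τ p ℤ.< rkτ τ q → r p < r q
  rkτ-<⁻ p q lt = ℤP.drop‿+<+ (subst₂ ℤ._<_ (rkτ≡r p) (rkτ≡r q) lt)

  rkτ-≤ : ∀ p q → r p ≤ r q → rkτ τ p ℤ.≤ rkτ τ q
  rkτ-≤ p q le = subst₂ ℤ._≤_ (sym (rkτ≡r p)) (sym (rkτ≡r q)) (ℤ.+≤+ le)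

  rkτ-≡⁻ : ∀ p q → rkτ τ p ≡ rkτ τ q → r p ≡ r q
  rkτ-≡⁻ p q eq = ℤP.+-injective (trans (sym (rkτ≡r p)) (trans eq (rkτ≡r q)))

  inX⇒ : ∀ p → T (inX τ p) → r p ≡ 0
  inX⇒ p t = ℤP.+-injective (trans (sym (rkτ≡r p)) (does⇒ (rkτ τ p ℤ.≟ + 0) t))

  ⇒inX : ∀ p → r p ≡ 0 → T (inX τ p)
  ⇒inX p e = ⇒does (rkτ τ p ℤ.≟ + 0) (trans (rkτ≡r p) (cong +_ e))

  r-column₀ : ∀ i → r (i , 0) ≡ 0
  r-column₀ i = cong₂ _∸_ (rk₀ (x τ)) (rk₀ (w τ))
    where
    rk₀ : (π : Perm n) → rk π (i , 0) ≡ 0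
    rk₀ π = trans (rk≡Rk π i 0) (sumTo-zero n _ (λ u → ind-false (λ t → <-irrefl refl (<ᵇ⇒< _ 0 (∧-snd {u <ᵇ i} t)))))

  Boxw Boxx : ℕ → ℕ → ℕ → ℕ → ℕ
  Boxw = Box n (graph (w τ))
  Boxx = Box n (graph (x τ))

  rk-rectangle : ∀ (π : Perm n) l i k j → l ≤ i → k ≤ j →
    rk π (i , j) + rk π (l , k) ≡ rk π (i , k) + rk π (l , j) + Box n (graph π) l i k j
  rk-rectangle π l i k j l≤i k≤j = trans (cong₂ _+_ (rk≡Rk π i j) (rk≡Rk π l k))
    (trans (Rk-rectangle n (graph π) l i k j l≤i k≤j)
      (sym (cong (_+ Box n (graph π) l i k j) (cong₂ _+_ (rk≡Rk π i k) (rk≡Rk π l j)))))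

  r-rectangle : ∀ l i k j → l ≤ i → k ≤ j →
    r (i , j) + r (l , k) + Boxw l i k j ≡ r (i , k) + r (l , j) + Boxx l i k j
  r-rectangle l i k j l≤i k≤j =
    rectangle-difference (rkw (i , j)) (rkw (l , k)) (rkw (i , k)) (rkw (l , j)) _ _ _ _ _ _
      (trans (sym (cong₂ _+_ (rkx≡rkw+r (i , j)) (rkx≡rkw+r (l , k))))
        (trans (rk-rectangle (x τ) l i k j l≤i k≤j)
          (cong (_+ Boxx l i k j) (cong₂ _+_ (rkx≡rkw+r (i , k)) (rkx≡rkw+r (l , j))))))
      (rk-rectangle (w τ) l i k j l≤i k≤j)

  r-rectangle-≤ : ∀ l i k j → l ≤ i → k ≤ j → r (i , j) ≤ r (i , k) + r (l , j) + Boxx l i k j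
  r-rectangle-≤ l i k j l≤i k≤j = subst (r (i , j) ≤_) (r-rectangle l i k j l≤i k≤j)
    (≤-trans (m≤m+n (r (i , j)) (r (l , k))) (m≤m+n _ (Boxw l i k j)))

  r-rectangle-corner : ∀ l i k j → l ≤ i → k ≤ j → r (l , k) ≡ 0 → Boxw l i k j ≡ 0 →
    r (i , j) ≡ r (i , k) + r (l , j) + Boxx l i k j
  r-rectangle-corner l i k j l≤i k≤j r₀ box₀ = trans zeros (r-rectangle l i k j l≤i k≤j)
    where
    zeros : r (i , j) ≡ r (i , j) + r (l , k) + Boxw l i k j
    zeros rewrite r₀ | box₀ = sym (trans (+-identityʳ _) (+-identityʳ _))

  D≡Boxw : ∀ l i k j → l ≤ i → k ≤ j → D (w τ) (i , j) (l , k) ≡ + Boxw l i k j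
  D≡Boxw l i k j l≤i k≤j =
    D-from-rectangle (rkw (i , j)) (rkw (l , k)) (rkw (i , k)) (rkw (l , j)) _ (rk-rectangle (w τ) l i k j l≤i k≤j)

  -- The test defining i⁻ for q = (i, j) on column k:
  -- (l, k) ∈ X_τ and D_w(q, (l, k)) = 0.
  cornerTest : Pt → ℕ → ℕ → Bool
  cornerTest q k l = inX τ (l , k) ∧ isZero (D (w τ) q (l , k))

  cornerTest⇒ : ∀ l i k j → l ≤ i → k ≤ j → T (cornerTest (i , j) k l) →
    r (l , k) ≡ 0 × Boxw l i k j ≡ 0
  cornerTest⇒ l i k j l≤i k≤j t =
    inX⇒ (l , k) (∧-fst t) ,
    ℤP.+-injective (trans (sym (D≡Boxw l i k j l≤i k≤j)) (does⇒ (D (w τ) (i , j) (l , k) ℤ.≟ + 0) (∧-snd {inX τ (l , k)} t)))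

  ⇒cornerTest : ∀ l i k j → l ≤ i → k ≤ j → r (l , k) ≡ 0 → Boxw l i k j ≡ 0 →
    T (cornerTest (i , j) k l)
  ⇒cornerTest l i k j l≤i k≤j r₀ box₀ =
    ∧-intro (⇒inX (l , k) r₀) (⇒does (D (w τ) (i , j) (l , k) ℤ.≟ + 0) (trans (D≡Boxw l i k j l≤i k≤j) (cong +_ box₀)))

-- The corner analysis of Lemma 4.4 for p = (i, j), j = 1 + j₀, with ¬P↑(p).
-- Here (i', j') = p^↖ and p' = (i', j).
module Corner {n : ℕ} (τ : Pair n) (i j₀ : ℕ) (¬P↑ : ¬ Arrows.Pup τ (i , suc j₀)) where
  open Arrows τ
  open PairRank τ

  j : ℕ
  j = suc j₀

  p : Pt
  p = (i , j)

  j' : ℕ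
  j' = jminus p

  j'≤j₀ : j' ≤ j₀
  j'≤j₀ = maxFrom-≤ (λ k → inX τ (i , k)) 0 j₀

  j'≤j : j' ≤ j
  j'≤j = m≤n⇒m≤1+n j'≤j₀

  r-i-j' : r (i , j') ≡ 0
  r-i-j' = inX⇒ (i , j') (maxFrom-sat (λ k → inX τ (i , k)) 0 j₀ (⇒inX (i , 0) (r-column₀ i)))

  row-nonzero : ∀ k → j' < k → k ≤ j₀ → r (i , k) ≢ 0
  row-nonzero k j'<k k≤j₀ r₀ = maxFrom-above (λ k → inX τ (i , k)) 0 j₀ k j'<k k≤j₀ (⇒inX (i , k) r₀)

  i' : ℕ
  i' = iminus p

  i'≤i : i' ≤ i
  i'≤i = minTo-≤ (cornerTest p j') i i

  corner-i' : r (i' , j') ≡ 0 × Boxw i' i j' j ≡ 0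
  corner-i' = cornerTest⇒ i' i j' j i'≤i j'≤j (minTo-sat (cornerTest p j') i i
    (⇒cornerTest i i j' j ≤-refl j'≤j r-i-j' (Box-empty n (graph (w τ)) i j' j)))

  minimal-i' : ∀ l → l < i' → ¬ T (cornerTest p j' l)
  minimal-i' = minTo-below₀ (cornerTest p j') i

  r-p≡ : r p ≡ r (i' , j) + Boxx i' i j' j
  r-p≡ = trans (r-rectangle-corner i' i j' j i'≤i j'≤j (proj₁ corner-i') (proj₂ corner-i'))
               (cong (λ z → z + r (i' , j) + Boxx i' i j' j) r-i-j')

  -- ¬P↑(p) says r(i',j) is not below r(p), so the x-box is empty.
  Boxx-empty : Boxx i' i j' j ≡ 0
  Boxx-empty = ≮-+⇒≡0 (r (i' , j)) (Boxx i' i j' j)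
    (λ lt → ¬P↑ (rkτ-< (i' , j) p (subst (r (i' , j) <_) (sym r-p≡) lt)))

  r-p'≡r-p : r (i' , j) ≡ r p
  r-p'≡r-p = sym (trans r-p≡ (trans (cong (λ z → r (i' , j) + z) Boxx-empty) (+-identityʳ _)))

  module Between (i₁ : ℕ) (i'≤i₁ : i' ≤ i₁) (i₁≤i : i₁ ≤ i) where

    q : Pt
    q = (i₁ , j)

    Boxw-i'-i₁ : Boxw i' i₁ j' j ≡ 0
    Boxw-i'-i₁ = n≤0⇒n≡0 (subst (Boxw i' i₁ j' j ≤_) (proj₂ corner-i')
      (Box-mono n (graph (w τ)) ≤-refl i₁≤i ≤-refl ≤-refl))

    r-q≡ : r q ≡ r (i₁ , j') + r p + Boxx i' i₁ j' j
    r-q≡ = trans (r-rectangle-corner i' i₁ j' j i'≤i₁ j'≤j (proj₁ corner-i') Boxw-i'-i₁)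
                 (cong (λ z → r (i₁ , j') + z + Boxx i' i₁ j' j) r-p'≡r-p)

    rank-≥ : r p ≤ r q
    rank-≥ = subst (r p ≤_) (sym r-q≡) (≤-trans (m≤n+m (r p) (r (i₁ , j'))) (m≤m+n _ _))

    module SameRank (same : r q ≡ r p) where

      r-i₁-j' : r (i₁ , j') ≡ 0
      r-i₁-j' = n≤0⇒n≡0 (+-cancelʳ-≤ (r p) (r (i₁ , j')) 0
        (subst (r (i₁ , j') + r p ≤_) (trans (sym r-q≡) same) (m≤m+n _ (Boxx i' i₁ j' j))))

      -- A zero (i₁, k) with j' < k < j would give a zero (i, k).
      row-nonzero₁ : ∀ k → j' < k → k ≤ j₀ → ¬ T (inX τ (i₁ , k))
      row-nonzero₁ k j'<k k≤j₀ t =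
        row-nonzero k j'<k k≤j₀ (n≤0⇒n≡0 (subst (r (i , k) ≤_) zeros
          (r-rectangle-≤ i₁ i j' k i₁≤i (<⇒≤ j'<k))))
        where
        Boxx₀ : Boxx i₁ i j' k ≡ 0
        Boxx₀ = n≤0⇒n≡0 (subst (Boxx i₁ i j' k ≤_) Boxx-empty
          (Box-mono n (graph (x τ)) i'≤i₁ ≤-refl ≤-refl (m≤n⇒m≤1+n k≤j₀)))
        zeros : r (i , j') + r (i₁ , k) + Boxx i₁ i j' k ≡ 0
        zeros rewrite r-i-j' | inX⇒ (i₁ , k) t | Boxx₀ = refl

      left-q : jminus q ≡ j'
      left-q = maxFrom-unique (λ k → inX τ (i₁ , k)) 0 j₀ j' j'≤j₀
        (⇒inX (i₁ , 0) (r-column₀ i₁)) (⇒inX (i₁ , j') r-i₁-j') row-nonzero₁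

      -- A row l < i' passing the test of q would pass the test of p.
      below-i' : ∀ l → l < i' → ¬ T (cornerTest q j' l)
      below-i' l l<i' t =
        minimal-i' l l<i' (⇒cornerTest l i j' j (≤-trans l≤i₁ i₁≤i) j'≤j (proj₁ corner-l) Boxw₀)
        where
        l≤i₁ : l ≤ i₁
        l≤i₁ = <⇒≤ (<-≤-trans l<i' i'≤i₁)
        corner-l : r (l , j') ≡ 0 × Boxw l i₁ j' j ≡ 0
        corner-l = cornerTest⇒ l i₁ j' j l≤i₁ j'≤j t
        Boxw-i₁-i : Boxw i₁ i j' j ≡ 0
        Boxw-i₁-i = n≤0⇒n≡0 (subst (Boxw i₁ i j' j ≤_) (proj₂ corner-i')
          (Box-mono n (graph (w τ)) i'≤i₁ ≤-refl ≤-refl ≤-refl))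
        Boxw₀ : Boxw l i j' j ≡ 0
        Boxw₀ = n≤0⇒n≡0 (subst (Boxw l i j' j ≤_) (cong₂ _+_ (proj₂ corner-l) Boxw-i₁-i)
          (Box-split n (graph (w τ)) l i₁ i j' j))

      up-q : iminus q ≡ i'
      up-q = trans (cong (λ k → minTo (cornerTest q k) i₁ i₁) left-q)
        (minTo-unique (cornerTest q j') i₁ i'
          (⇒cornerTest i₁ i₁ j' j ≤-refl j'≤j r-i₁-j' (Box-empty n (graph (w τ)) i₁ j' j))
          (⇒cornerTest i' i₁ j' j i'≤i₁ j'≤j (proj₁ corner-i') Boxw-i'-i₁)
          below-i')

      ¬P↑-q : ¬ Pup q
      ¬P↑-q pu = <-irrefl (trans r-p'≡r-p (sym same))
        (subst (λ z → r (z , j) < r q) up-q (rkτ-<⁻ (up q) q pu))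

  between : ∀ i₁ → i' ≤ i₁ → i₁ ≤ i →
    (rkτ τ p ℤ.≤ rkτ τ (i₁ , j))
    × (rkτ τ (i₁ , j) ≡ rkτ τ p →
         (up (i₁ , j) ≡ (i' , j)) × (left (i₁ , j) ≡ (i₁ , j')) × ¬ Pup (i₁ , j))
  between i₁ i'≤i₁ i₁≤i =
    rkτ-≤ p (i₁ , j) B.rank-≥ ,
    λ same → let open B.SameRank (rkτ-≡⁻ (i₁ , j) p same)
             in cong (_, j) up-q , cong (i₁ ,_) left-q , ¬P↑-q
    where
    module B = Between i₁ i'≤i₁ i₁≤i

  -- Parts (1) and (3): p' itself lies between p' and p and has the rank of p.
  module AtUp = Between.SameRank i' ≤-refl i'≤i r-p'≡r-p

  up-maximal : up (i' , j) ≡ (i' , j)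
  up-maximal = cong (_, j) AtUp.up-q

  left-of-up : left (i' , j) ≡ (i' , j')
  left-of-up = cong (i' ,_) AtUp.left-q

  -- Part (4): the ↓-arrow from p' cannot land at or above row i, since
  -- there the rank is at least r(p) = r(p').
  down-beyond : Qup p → ∃ λ i'' → (down (i' , j) ≡ (i'' , j)) × i < i''
  down-beyond (inj₁ P↑) = ⊥-elim (¬P↑ P↑)
  down-beyond (inj₂ P↓) with iplus (i' , j) ≤? i
  ... | yes i⁺≤i = ⊥-elim (<⇒≱ (rkτ-<⁻ (down (i' , j)) (i' , j) P↓)
        (subst (_≤ r (iplus (i' , j) , j)) (sym r-p'≡r-p)
          (Between.rank-≥ (iplus (i' , j)) (maxFrom-≥ _ i' (n ∸ i')) i⁺≤i)))
  ... | no i⁺≰i = iplus (i' , j) , refl , ≰⇒> i⁺≰i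

lemma4p4 : (n : ℕ) (τ : Pair n) (i j : ℕ) → i ≤ n → j ≤ n →
    rkτ τ (i , j) ≢ ℤ.+ 0 →
    let open Arrows τ
        p = (i , j)
        i' = iminus p
        j' = jminus p
        p' = up p
    in ¬ Pup p →
       (up p' ≡ p')
       × (∀ i₁ → i' ≤ i₁ → i₁ ≤ i →
            (rkτ τ p ℤ.≤ rkτ τ (i₁ , j))
            × (rkτ τ (i₁ , j) ≡ rkτ τ p →
                 (up (i₁ , j) ≡ p') × (left (i₁ , j) ≡ (i₁ , j')) × ¬ Pup (i₁ , j)))
       × (left p' ≡ nw p)
       × (Qup p → ∃ λ i'' → (down p' ≡ (i'' , j)) × i < i'')
-- Column 0 lies in X_τ, so j ≥ 1 and the corner analysis applies.
lemma4p4 n τ i zero _ _ p∉X _ =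
  ⊥-elim (p∉X (trans (PairRank.rkτ≡r τ (i , 0)) (cong +_ (PairRank.r-column₀ τ i))))
lemma4p4 n τ i (suc j₀) _ _ _ ¬P↑ = up-maximal , between , left-of-up , down-beyond
  where open Corner τ i j₀ ¬P↑
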